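{- Let $G$ be a connected graph of order $n\geq 3$. Then the following are equivalent: (1) $sdiam_3(G)=2$; (2) $0\leq \Delta(\overline{G})\leq 1$; (3) $n-2\leq \delta(G)\leq n-1$.
   Context: All graphs are finite, simple and undirected; $\overline{G}$ denotes the complement of $G$, and $\Delta$, $\delta$ denote maximum and minimum degree. For a graph $G$ and $S\subseteq V(G)$ with $|S|\geq 2$, the Steiner distance $d_G(S)$ is the minimum number of edges of a connected subgraph (equivalently, a tree) of $G$ whose vertex set contains $S$; $d_G(S)=\infty$ if no such subgraph exists. For $2\leq k\leq n$ and $v\in V(G)$, the Steiner $k$-eccentricity is $e_k(v)=\max\{d_G(S): S\subseteq V(G), |S|=k, v\in S\}$, and the Steiner $k$-diameter is $sdiam_k(G)=\max\{e_k(v): v\in V(G)\}$, i.e. the maximum of $d_G(S)$ over all $k$-subsets $S$ of $V(G)$. -}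

module Defs where

open import Data.Nat using (ℕ; zero; suc; _+_; _≤_; _<ᵇ_; _⊔_; _⊓_)
open import Data.Fin using (Fin; toℕ)
open import Data.Bool using (Bool; true; false; _∧_; not)
open import Data.List using (List; []; _∷_; length; filterᵇ; allFin; map; foldr)
open import Data.Nat.ListAction using (sum)
open import Data.Product using (Σ; _×_; ∃)
open import Relation.Binary.PropositionalEquality using (_≡_; _≢_)
open import Relation.Nullary using (¬_)
open import Relation.Nullary.Decidable using (⌊_⌋)
open import Data.Fin using (_≟_)

record Graph (n : ℕ) : Set where
  field
    adj    : Fin n → Fin n → Bool
    adj-sym : ∀ u v → adj u v ≡ adj v u
    adj-irrefl : ∀ v → adj v v ≡ false
open Graph public

complement : ∀ {n} → Graph n → Graph n
complement {n} G = record
  { adj = λ u v → not ⌊ u ≟ v ⌋ ∧ not (adj G u v)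
  ; adj-sym = symC
  ; adj-irrefl = irC }
  where
  open import Relation.Binary.PropositionalEquality using (refl; sym; cong₂)
  open import Relation.Nullary using (yes; no)
  symC : ∀ u v → (not ⌊ u ≟ v ⌋ ∧ not (adj G u v)) ≡ (not ⌊ v ≟ u ⌋ ∧ not (adj G v u))
  symC u v with u ≟ v | v ≟ u
  ... | yes _ | yes _ = refl
  ... | no _  | no _  rewrite Graph.adj-sym G u v = refl
  ... | yes p | no q  = Data.Empty.⊥-elim (q (sym p))
    where import Data.Empty
  ... | no p  | yes q = Data.Empty.⊥-elim (p (sym q))
    where import Data.Empty
  irC : ∀ v → (not ⌊ v ≟ v ⌋ ∧ not (adj G v v)) ≡ false
  irC v with v ≟ v
  ... | yes _ = refl
  ... | no p  = Data.Empty.⊥-elim (p refl)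
    where import Data.Empty

countV : ∀ {n} → (Fin n → Bool) → ℕ
countV {n} p = length (filterᵇ p (allFin n))

degree : ∀ {n} → Graph n → Fin n → ℕ
degree G v = countV (adj G v)

-- Maximum degree Δ(G) (0 for the empty graph).
maxDeg : ∀ {n} → Graph n → ℕ
maxDeg {n} G = foldr _⊔_ 0 (map (degree G) (allFin n))

-- Minimum degree δ(G) (for n ≥ 1; the seed n bounds all degrees).
minDeg : ∀ {n} → Graph n → ℕ
minDeg {n} G = foldr _⊓_ n (map (degree G) (allFin n))

data Reach {n : ℕ} (E : Fin n → Fin n → Bool) : Fin n → Fin n → Set where
  here : ∀ {u} → Reach E u u
  step : ∀ {u w v} → E u w ≡ true → Reach E w v → Reach E u v

Connected : ∀ {n} → Graph n → Set
Connected {n} G = ∀ (u v : Fin n) → Reach (adj G) u v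

record Subgraph {n : ℕ} (G : Graph n) : Set where
  field
    W      : Fin n → Bool
    E      : Fin n → Fin n → Bool
    E⊆adj  : ∀ u v → E u v ≡ true → adj G u v ≡ true
    E-sym  : ∀ u v → E u v ≡ E v u
    E-ends : ∀ u v → E u v ≡ true → W u ≡ true
open Subgraph public

SubConnected : ∀ {n} {G : Graph n} → Subgraph G → Set
SubConnected {n} H = ∀ (u v : Fin n) → W H u ≡ true → W H v ≡ true → Reach (E H) u v

-- Number of edges of H (unordered pairs {i,j}, counted once with i < j).
edgeCount : ∀ {n} {G : Graph n} → Subgraph G → ℕ
edgeCount {n} H = sum (map (λ i → countV (λ j → E H i j ∧ (toℕ i <ᵇ toℕ j))) (allFin n))

VSet : ℕ → Set
VSet n = Fin n → Bool

card : ∀ {n} → VSet n → ℕ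
card = countV

Contains : ∀ {n} {G : Graph n} → Subgraph G → VSet n → Set
Contains {n} H S = ∀ (v : Fin n) → S v ≡ true → W H v ≡ true

-- SteinerDist G S d : d is the Steiner distance d_G(S), i.e. the minimum
-- number of edges of a connected subgraph of G whose vertex set contains S
-- (the finite case; d_G(S) = ∞ corresponds to no d satisfying this).
SteinerDist : ∀ {n} → Graph n → VSet n → ℕ → Set
SteinerDist G S d =
  (Σ (Subgraph G) λ H → SubConnected H × Contains H S × edgeCount H ≡ d)
  × (∀ (H : Subgraph G) → SubConnected H → Contains H S → d ≤ edgeCount H)

-- SteinerDiam G k m : sdiam_k(G) = m, i.e. m is the maximum of d_G(S)
-- over all k-subsets S (all of which are finite here).
SteinerDiam : ∀ {n} → Graph n → ℕ → ℕ → Set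
SteinerDiam {n} G k m =
  (Σ (VSet n) λ S → card S ≡ k × SteinerDist G S m)
  × (∀ (S : VSet n) → card S ≡ k → Σ ℕ λ d → SteinerDist G S d × d ≤ m)

-- Call G nearly complete when every vertex misses at most one other vertex,
-- i.e. every degree in Ḡ is at most 1.  The proof has three ingredients.
--
-- * Counting.  We count by recursion over Fin n, show that every Boolean
--   predicate is enumerated by a duplicate-free list of length its count, and
--   count the edges of a symmetric loopless relation by deleting one edge at a
--   time: a relation containing k distinct edges has at least k edges, and a
--   relation covered by a list of k edges has at most k edges.
-- * Degrees.  deg_G(v) + deg_Ḡ(v) = n - 1, which turns "Δ(Ḡ) ≤ 1" into
--   "n - 2 ≤ δ(G) ≤ n - 1" (second equivalence).
-- * Steiner distances of triples.  A connected subgraph containing three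
--   vertices has at least 2 edges, and at least 3 if one of the vertices is
--   adjacent to neither of the others.  In a nearly complete graph some vertex
--   of every triple is adjacent to the other two, and this cherry realises
--   distance 2; conversely a vertex with two non-neighbours spans a triple of
--   distance ≥ 3 (first equivalence).
module Submission where

open import Defs
open import Data.Nat using (ℕ; _≤_; _∸_)
open import Data.Product using (_×_)
open import Function.Bundles using (_⇔_)

open import Data.Nat using (zero; suc; _+_; z≤n; s≤s; z<s; _≤?_)
open import Data.Nat.Properties
  using ( suc-injective; ≤-refl; ≤-trans; ≤-reflexive; ≤-antisym; m≤n⇒m≤1+n; +-suc; +-comm; +-monoʳ-≤
        ; m≤m+n; m<m+n; <⇒≱; ≰⇒>; m∸n≤m; m≤n+o⇒m∸n≤o; ⊔-lub; ⊓-glb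
        ; m⊔n≤o⇒m≤o; m⊔n≤o⇒n≤o; m≤n⊓o⇒m≤n; m≤n⊓o⇒m≤o; m≤n⇒o⊓m≤n )
open import Data.Fin using (Fin; _≟_; _<_; _<?_) renaming (zero to fzero; suc to fsuc)
open import Data.Fin.Properties using (<-cmp; <-asym; <-irrefl) renaming (suc-injective to fsuc-injective)
open import Data.Bool using (Bool; true; false; _∧_; _∨_; not)
open import Data.Bool.Properties using (∧-zeroʳ; ∧-identityʳ)
open import Data.List using (List; []; _∷_; length; filterᵇ; tabulate; allFin; map)
open import Data.Nat.ListAction using (sum)
open import Data.List.Properties using (foldr-preservesᵇ; foldr-forcesᵇ; foldr-preservesʳ)
open import Data.List.Relation.Unary.Any using (Any; here; there; any?)
import Data.List.Relation.Unary.Any as Any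
open import Data.List.Relation.Unary.All using (All; []; _∷_)
import Data.List.Relation.Unary.All as All
open import Data.List.Relation.Unary.All.Properties using (map⁺; map⁻; tabulate⁺)
open import Data.List.Relation.Unary.All.Properties.Core using (¬Any⇒All¬; All¬⇒¬Any)
open import Data.List.Relation.Unary.AllPairs using (AllPairs; []; _∷_)
open import Data.List.Relation.Unary.Unique.Propositional using (Unique)
open import Data.List.Membership.Propositional using (_∈_)
open import Data.List.Membership.Propositional.Properties using (∈-allFin)
open import Data.List.Relation.Binary.Permutation.Propositional using (_↭_; ↭-refl; swap)
open import Data.List.Relation.Binary.Permutation.Propositional.Properties using (∈-resp-↭; shift)
open import Data.Product using (Σ; ∃; _,_; proj₁; proj₂)
open import Data.Sum using (_⊎_; inj₁; inj₂)
open import Function using (_∘_)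
open import Function.Bundles using (mk⇔; Equivalence)
open import Relation.Binary using (tri<; tri≈; tri>)
open import Relation.Binary.PropositionalEquality
  using (_≡_; _≢_; refl; sym; trans; cong; cong₂; subst; module ≡-Reasoning)
open import Relation.Nullary using (¬_; Dec; yes; no; does; contradiction)
open import Relation.Nullary.Decidable using (⌊_⌋; _×-dec_; _⊎-dec_; dec-true; dec-false; does-⇔; isYes≗does)

private
  variable
    n : ℕ

does-sound : ∀ {A : Set} (a? : Dec A) → does a? ≡ true → A
does-sound (yes a) _ = a

false≢true : false ≢ true
false≢true ()

-- Counting over Fin n, by recursion on n.

total : (Fin n → ℕ) → ℕ
total {zero}  f = 0
total {suc n} f = f fzero + total (f ∘ fsuc)

indicator : Bool → ℕ
indicator true  = 1
indicator false = 0

count : (Fin n → Bool) → ℕ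
count p = total (indicator ∘ p)

total-ext : {f g : Fin n → ℕ} → (∀ x → f x ≡ g x) → total f ≡ total g
total-ext {zero}  eq = refl
total-ext {suc n} eq = cong₂ _+_ (eq fzero) (total-ext (eq ∘ fsuc))

count-ext : {p q : Fin n → Bool} → (∀ x → p x ≡ q x) → count p ≡ count q
count-ext eq = total-ext (cong indicator ∘ eq)

total-zero : (f : Fin n → ℕ) → (∀ x → f x ≡ 0) → total f ≡ 0
total-zero {zero}  f z = refl
total-zero {suc n} f z = cong₂ _+_ (z fzero) (total-zero (f ∘ fsuc) (z ∘ fsuc))

total-point : (f g : Fin n → ℕ) (x : Fin n) → f x ≡ suc (g x) →
  (∀ y → y ≢ x → f y ≡ g y) → total f ≡ suc (total g)
total-point {suc n} f g fzero fx others =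
  cong₂ _+_ fx (total-ext (λ y → others (fsuc y) (λ ())))
total-point {suc n} f g (fsuc x) fx others =
  trans (cong₂ _+_ (others fzero (λ ()))
                   (total-point (f ∘ fsuc) (g ∘ fsuc) x fx (λ y y≢x → others (fsuc y) (y≢x ∘ fsuc-injective))))
        (+-suc (g fzero) _)

count-point : (p q : Fin n → Bool) (x : Fin n) → p x ≡ true → q x ≡ false →
  (∀ y → y ≢ x → p y ≡ q y) → count p ≡ suc (count q)
count-point p q x px qx others =
  total-point _ _ x (trans (cong indicator px) (sym (cong (suc ∘ indicator) qx)))
    (λ y y≢x → cong indicator (others y y≢x))

count-zero : (p : Fin n → Bool) → count p ≡ 0 → ∀ x → p x ≡ false
count-zero {suc n} p c fzero with p fzero
... | false = refl
count-zero {suc n} p c (fsuc x) with p fzero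
... | false = count-zero (p ∘ fsuc) c x

count-positive : (p : Fin n → Bool) {k : ℕ} → count p ≡ suc k → ∃ λ x → p x ≡ true
count-positive {suc n} p c with p fzero in p0
... | true  = fzero , p0
... | false = let x , px = count-positive (p ∘ fsuc) c in fsuc x , px

count-complement : (p : Fin n → Bool) → count p + count (not ∘ p) ≡ n
count-complement {zero}  p = refl
count-complement {suc n} p with p fzero
... | true  = cong suc (count-complement (p ∘ fsuc))
... | false = trans (+-suc _ _) (cong suc (count-complement (p ∘ fsuc)))

-- `countV` and `edgeCount` from Defs count by filtering and summing lists; they agree
-- with `count` and `total`.
length-filter : ∀ {A : Set} (f : Fin n → A) (p : A → Bool) →
  length (filterᵇ p (tabulate f)) ≡ count (p ∘ f)
length-filter {zero}  f p = refl
length-filter {suc n} f p with p (f fzero)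
... | true  = cong suc (length-filter (f ∘ fsuc) p)
... | false = length-filter (f ∘ fsuc) p

sum-tabulate : ∀ {A : Set} (f : Fin n → A) (g : A → ℕ) → sum (map g (tabulate f)) ≡ total (g ∘ f)
sum-tabulate {zero}  f g = refl
sum-tabulate {suc n} f g = cong (g (f fzero) +_) (sum-tabulate (f ∘ fsuc) g)

countV≡count : (p : Fin n → Bool) → countV p ≡ count p
countV≡count p = length-filter (λ x → x) p

-- Vertex sets of lists, and lists enumerating vertex sets.

listSet : List (Fin n) → VSet n
listSet xs y = does (any? (y ≟_) xs)

listSet-∈ : ∀ {xs : List (Fin n)} {y} → y ∈ xs → listSet xs y ≡ true
listSet-∈ {xs = xs} {y} = dec-true (any? (y ≟_) xs)

∈-listSet : ∀ {xs : List (Fin n)} {y} → listSet xs y ≡ true → y ∈ xs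
∈-listSet {xs = xs} {y} = does-sound (any? (y ≟_) xs)

_∖_ : VSet n → Fin n → VSet n
(p ∖ x) y = p y ∧ not (does (y ≟ x))

∖-self : (p : VSet n) (x : Fin n) → (p ∖ x) x ≡ false
∖-self p x = trans (cong (λ b → p x ∧ not b) (dec-true (x ≟ x) refl)) (∧-zeroʳ (p x))

∖-other : (p : VSet n) {x y : Fin n} → y ≢ x → (p ∖ x) y ≡ p y
∖-other p {x} {y} y≢x = trans (cong (λ b → p y ∧ not b) (dec-false (y ≟ x) y≢x)) (∧-identityʳ (p y))

count-∖ : (p : VSet n) {x : Fin n} → p x ≡ true → count p ≡ suc (count (p ∖ x))
count-∖ p {x} px = count-point p (p ∖ x) x px (∖-self p x) (λ y y≢x → sym (∖-other p y≢x))

count-listSet : (xs : List (Fin n)) → Unique xs → count (listSet xs) ≡ length xs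
count-listSet {n} []   []              = total-zero {n} (indicator ∘ listSet []) (λ _ → refl)
count-listSet (x ∷ xs) (x∉xs ∷ unique) =
  trans (count-point (listSet (x ∷ xs)) (listSet xs) x
          (listSet-∈ {xs = x ∷ xs} (here refl))
          (dec-false (any? (x ≟_) xs) (All¬⇒¬Any x∉xs))
          (λ y y≢x → cong (_∨ listSet xs y) (dec-false (y ≟ x) y≢x)))
        (cong suc (count-listSet xs unique))

enumerate : ∀ k (p : VSet n) → count p ≡ k →
  Σ (List (Fin n)) λ xs → Unique xs × length xs ≡ k × (∀ y → p y ≡ listSet xs y)
enumerate zero    p c = [] , [] , refl , count-zero p c
enumerate (suc k) p c with count-positive p c
... | x , px with enumerate k (p ∖ x) (suc-injective (trans (sym (count-∖ p px)) c))
... | xs , unique , len , p∖x≡xs = x ∷ xs , x∉xs ∷ unique , cong suc len , members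
  where
  x∉xs : All (x ≢_) xs
  x∉xs = ¬Any⇒All¬ xs λ x∈xs →
    false≢true (trans (sym (∖-self p x)) (trans (p∖x≡xs x) (listSet-∈ x∈xs)))
  members : ∀ y → p y ≡ does (y ≟ x) ∨ listSet xs y
  members y with y ≟ x
  ... | yes refl = px
  ... | no y≢x   = trans (sym (∖-other p y≢x)) (p∖x≡xs y)

count≤1-unique : (p : VSet n) → count p ≤ 1 → ∀ {y z} → p y ≡ true → p z ≡ true → y ≡ z
count≤1-unique {n} p c≤1 {y} {z} py pz with enumerate (count p) p refl
... | xs , _ , len , p≡xs = atMostOne xs (≤-trans (≤-reflexive len) c≤1)
                               (∈-listSet (trans (sym (p≡xs y)) py)) (∈-listSet (trans (sym (p≡xs z)) pz))
  where
  atMostOne : (xs : List (Fin n)) → length xs ≤ 1 → y ∈ xs → z ∈ xs → y ≡ z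
  atMostOne (_ ∷ [])    _           (here y≡w) (here z≡w) = trans y≡w (sym z≡w)
  atMostOne (_ ∷ _ ∷ _) (s≤s ())    _          _

2≤count-two : (p : VSet n) → 2 ≤ count p →
  Σ (Fin n) λ a → Σ (Fin n) λ b → a ≢ b × p a ≡ true × p b ≡ true
2≤count-two {n} p 2≤c with enumerate (count p) p refl
... | xs , unique , len , p≡xs = twoOf xs unique (≤-trans 2≤c (≤-reflexive (sym len))) p≡xs
  where
  twoOf : (xs : List (Fin n)) → Unique xs → 2 ≤ length xs → (∀ y → p y ≡ listSet xs y) →
    Σ (Fin n) λ a → Σ (Fin n) λ b → a ≢ b × p a ≡ true × p b ≡ true
  twoOf xs@(a ∷ b ∷ _) ((a≢b ∷ _) ∷ _) _ p≡xs =
    a , b , a≢b , trans (p≡xs a) (listSet-∈ {xs = xs} (here refl))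
                , trans (p≡xs b) (listSet-∈ {xs = xs} (there (here refl)))
  twoOf (_ ∷ []) _ (s≤s ()) _

-- Counting the edges of a symmetric loopless Boolean relation on Fin n.

Adjacency : ℕ → Set
Adjacency n = Fin n → Fin n → Bool

Symmetric : Adjacency n → Set
Symmetric E = ∀ i j → E i j ≡ E j i

Loopless : Adjacency n → Set
Loopless E = ∀ i → E i i ≡ false

Edge : ℕ → Set
Edge n = Fin n × Fin n

SameEdge : Edge n → Fin n → Fin n → Set
SameEdge (a , b) i j = (i ≡ a × j ≡ b) ⊎ (i ≡ b × j ≡ a)

sameEdge? : (e : Edge n) (i j : Fin n) → Dec (SameEdge e i j)
sameEdge? (a , b) i j = ((i ≟ a) ×-dec (j ≟ b)) ⊎-dec ((i ≟ b) ×-dec (j ≟ a))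

SameEdge-flip : ∀ {e : Edge n} {i j} → SameEdge e i j → SameEdge e j i
SameEdge-flip (inj₁ (p , q)) = inj₂ (q , p)
SameEdge-flip (inj₂ (p , q)) = inj₁ (q , p)

SameEdge-reverse : ∀ {a b i j : Fin n} → SameEdge (a , b) i j → SameEdge (b , a) i j
SameEdge-reverse (inj₁ pq) = inj₂ pq
SameEdge-reverse (inj₂ pq) = inj₁ pq

HasEdge : Adjacency n → Edge n → Set
HasEdge E (a , b) = E a b ≡ true

DistinctEdges : Edge n → Edge n → Set
DistinctEdges e (i , j) = ¬ SameEdge e i j

Covers : List (Edge n) → Adjacency n → Set
Covers es E = ∀ i j → E i j ≡ true → Any (λ e → SameEdge e i j) es

edgeTotal : Adjacency n → ℕ
edgeTotal E = total (λ i → count (λ j → E i j ∧ does (i <? j)))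

edgeTotal-ext : {E E′ : Adjacency n} → (∀ i j → E i j ≡ E′ i j) → edgeTotal E ≡ edgeTotal E′
edgeTotal-ext eq = total-ext (λ i → count-ext (λ j → cong (_∧ _) (eq i j)))

edgeTotal-empty : (E : Adjacency n) → (∀ i j → E i j ≡ false) → edgeTotal E ≡ 0
edgeTotal-empty E none = total-zero _ (λ i → total-zero _ (λ j → cong (indicator ∘ (_∧ _)) (none i j)))

edgeCount≡edgeTotal : {G : Graph n} (H : Subgraph G) → edgeCount H ≡ edgeTotal (E H)
edgeCount≡edgeTotal {n} H =
  trans (sum-tabulate (λ x → x) (λ i → countV (λ j → E H i j ∧ does (i <? j))))
        (total-ext (λ i → countV≡count (λ j → E H i j ∧ does (i <? j))))

delete : Edge n → Adjacency n → Adjacency n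
delete e E i j = E i j ∧ not (does (sameEdge? e i j))

delete-same : ∀ {e} (E : Adjacency n) {i j} → SameEdge e i j → delete e E i j ≡ false
delete-same {e = e} E {i} {j} s =
  trans (cong (λ b → E i j ∧ not b) (dec-true (sameEdge? e i j) s)) (∧-zeroʳ (E i j))

delete-other : ∀ {e} (E : Adjacency n) {i j} → ¬ SameEdge e i j → delete e E i j ≡ E i j
delete-other {e = e} E {i} {j} ns =
  trans (cong (λ b → E i j ∧ not b) (dec-false (sameEdge? e i j) ns)) (∧-identityʳ (E i j))

delete-sound : ∀ {e} (E : Adjacency n) {i j} → delete e E i j ≡ true → E i j ≡ true × ¬ SameEdge e i j
delete-sound {e = e} E {i} {j} d = trans (sym (delete-other E ns)) d , ns
  where
  ns : ¬ SameEdge e i j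
  ns s = false≢true (trans (sym (delete-same E s)) d)

delete-symmetric : ∀ e {E : Adjacency n} → Symmetric E → Symmetric (delete e E)
delete-symmetric e E-sym i j =
  cong₂ (λ x s → x ∧ not s) (E-sym i j)
        (does-⇔ (mk⇔ (SameEdge-flip {e = e}) SameEdge-flip) (sameEdge? e i j) (sameEdge? e j i))

delete-loopless : ∀ e {E : Adjacency n} → Loopless E → Loopless (delete e E)
delete-loopless e E-loop i = cong (_∧ not (does (sameEdge? e i i))) (E-loop i)

-- Removing an edge a < b lowers row a by one and leaves the other rows alone.
edgeTotal-delete< : (E : Adjacency n) {a b : Fin n} → a < b → E a b ≡ true →
  edgeTotal E ≡ suc (edgeTotal (delete (a , b) E))
edgeTotal-delete< E {a} {b} a<b eab = total-point _ _ a rowA otherRows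
  where
  rowA : count (λ j → E a j ∧ does (a <? j)) ≡ suc (count (λ j → delete (a , b) E a j ∧ does (a <? j)))
  rowA = count-point _ _ b
    (cong₂ _∧_ eab (dec-true (a <? b) a<b))
    (cong (_∧ _) (delete-same E (inj₁ (refl , refl))))
    (λ j j≢b → cong (_∧ _) (sym (delete-other E
      λ { (inj₁ (_ , j≡b)) → j≢b j≡b ; (inj₂ (a≡b , _)) → <-irrefl a≡b a<b })))
  otherRows : ∀ y → y ≢ a →
    count (λ j → E y j ∧ does (y <? j)) ≡ count (λ j → delete (a , b) E y j ∧ does (y <? j))
  otherRows y y≢a = count-ext entry
    where
    entry : ∀ j → E y j ∧ does (y <? j) ≡ delete (a , b) E y j ∧ does (y <? j)
    entry j with sameEdge? (a , b) y j
    ... | no ns                      = cong (_∧ _) (sym (delete-other E ns))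
    ... | yes (inj₁ (y≡a , _))       = contradiction y≡a y≢a
    ... | yes (inj₂ (refl , refl))   =
      trans (cong (E b a ∧_) b≮a)
            (trans (∧-zeroʳ (E b a)) (sym (trans (cong (delete (a , b) E b a ∧_) b≮a) (∧-zeroʳ _))))
      where b≮a = dec-false (b <? a) (<-asym a<b)

edgeTotal-delete : {E : Adjacency n} → Symmetric E → Loopless E → ∀ {a b} → E a b ≡ true →
  edgeTotal E ≡ suc (edgeTotal (delete (a , b) E))
edgeTotal-delete {E = E} E-sym E-loop {a} {b} eab with <-cmp a b
... | tri< a<b _ _ = edgeTotal-delete< E a<b eab
... | tri≈ _ refl _ = contradiction (trans (sym eab) (E-loop a)) (λ ())
... | tri> _ _ b<a =
  trans (edgeTotal-delete< E b<a (trans (E-sym b a) eab))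
        (cong suc (edgeTotal-ext (λ i j →
          cong (λ s → E i j ∧ not s)
               (does-⇔ (mk⇔ SameEdge-reverse SameEdge-reverse) (sameEdge? (b , a) i j) (sameEdge? (a , b) i j)))))

edgeTotal-≥ : {E : Adjacency n} → Symmetric E → Loopless E → (es : List (Edge n)) →
  All (HasEdge E) es → AllPairs DistinctEdges es → length es ≤ edgeTotal E
edgeTotal-≥ E-sym E-loop []       []          []               = z≤n
edgeTotal-≥ {E = E} E-sym E-loop ((a , b) ∷ es) (eab ∷ present) (fresh ∷ distinct)
  rewrite edgeTotal-delete E-sym E-loop eab =
  s≤s (edgeTotal-≥ (delete-symmetric (a , b) {E} E-sym) (delete-loopless (a , b) {E} E-loop) es
        (All.zipWith (λ { {i , j} (eij , ns) → trans (delete-other E ns) eij }) (present , fresh))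
        distinct)

edgeTotal-≤ : {E : Adjacency n} → Symmetric E → Loopless E → (es : List (Edge n)) →
  Covers es E → edgeTotal E ≤ length es
edgeTotal-≤ {E = E} E-sym E-loop [] covers =
  ≤-reflexive (edgeTotal-empty E none)
  where
  none : ∀ i j → E i j ≡ false
  none i j with E i j in eij
  ... | false = refl
  ... | true  with () ← covers i j eij
edgeTotal-≤ {E = E} E-sym E-loop ((a , b) ∷ es) covers with E a b in eab
... | true rewrite edgeTotal-delete E-sym E-loop eab =
  s≤s (edgeTotal-≤ (delete-symmetric (a , b) {E} E-sym) (delete-loopless (a , b) {E} E-loop) es covers′)
  where
  covers′ : Covers es (delete (a , b) E)
  covers′ i j d with delete-sound E d
  ... | eij , ns with covers i j eij
  ... | here s  = contradiction s ns
  ... | there c = c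
... | false = m≤n⇒m≤1+n (edgeTotal-≤ E-sym E-loop es covers′)
  where
  covers′ : Covers es E
  covers′ i j eij with covers i j eij
  ... | here (inj₁ (refl , refl)) = contradiction (trans (sym eab) eij) (λ ())
  ... | here (inj₂ (refl , refl)) = contradiction (trans (sym eab) (trans (E-sym a b) eij)) (λ ())
  ... | there c                   = c

edgesOf : List (Edge n) → Adjacency n
edgesOf es i j = does (any? (λ e → sameEdge? e i j) es)

edgesOf-symmetric : (es : List (Edge n)) → Symmetric (edgesOf es)
edgesOf-symmetric es i j =
  does-⇔ (mk⇔ (Any.map SameEdge-flip) (Any.map SameEdge-flip))
         (any? (λ e → sameEdge? e i j) es) (any? (λ e → sameEdge? e j i) es)

edgesOf-∋ : (es : List (Edge n)) {i j : Fin n} → Any (λ e → SameEdge e i j) es → edgesOf es i j ≡ true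
edgesOf-∋ es {i} {j} = dec-true (any? (λ e → sameEdge? e i j) es)

edgesOf-covers : (es : List (Edge n)) → Covers es (edgesOf es)
edgesOf-covers es i j = does-sound (any? (λ e → sameEdge? e i j) es)

-- Walks, and edge counts of subgraphs.

reach-trans : {E : Adjacency n} {x y z : Fin n} → Reach E x y → Reach E y z → Reach E x z
reach-trans here       r′ = r′
reach-trans (step e r) r′ = step e (reach-trans r r′)

reach-sym : {E : Adjacency n} → Symmetric E → {x y : Fin n} → Reach E x y → Reach E y x
reach-sym E-sym here                 = here
reach-sym E-sym (step {u} {w} e r) = reach-trans (reach-sym E-sym r) (step (trans (E-sym w u) e) here)

first-edge : {E : Adjacency n} {x y : Fin n} → Reach E x y → x ≢ y → ∃ λ w → E x w ≡ true
first-edge here               x≢y = contradiction refl x≢y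
first-edge (step {w = w} e _) _   = w , e

exit-edge : {E : Adjacency n} (P : VSet n) {x y : Fin n} → Reach E x y → P x ≡ true → P y ≡ false →
  Σ (Fin n) λ p → Σ (Fin n) λ q → P p ≡ true × P q ≡ false × E p q ≡ true
exit-edge P here px py = contradiction (trans (sym py) px) (λ ())
exit-edge P (step {w = w} e r) px py with P w in pw
... | false = _ , w , px , pw , e
... | true  = exit-edge P r pw py

module _ {G : Graph n} (H : Subgraph G) where

  subgraph-loopless : Loopless (E H)
  subgraph-loopless i with E H i i in eii
  ... | false = refl
  ... | true  = contradiction (trans (sym (E⊆adj H i i eii)) (adj-irrefl G i)) (λ ())

  edgeCount-≥ : (es : List (Edge n)) → All (HasEdge (E H)) es → AllPairs DistinctEdges es →
    length es ≤ edgeCount H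
  edgeCount-≥ es present distinct =
    ≤-trans (edgeTotal-≥ (E-sym H) subgraph-loopless es present distinct)
            (≤-reflexive (sym (edgeCount≡edgeTotal H)))

  edgeCount-≤ : (es : List (Edge n)) → Covers es (E H) → edgeCount H ≤ length es
  edgeCount-≤ es covers =
    ≤-trans (≤-reflexive (edgeCount≡edgeTotal H)) (edgeTotal-≤ (E-sym H) subgraph-loopless es covers)

-- Lower bounds on the size of connected subgraphs containing a triple.

module _ {G : Graph n} (H : Subgraph G) (connected : SubConnected H) where

  -- A connected subgraph containing three distinct vertices has at least 2 edges:
  -- an edge {a, x} leaves a, and a vertex z ∈ {b, c} outside {a, x} has an edge of its own.
  triple-two-edges : {a b c : Fin n} → a ≢ b → a ≢ c → b ≢ c →
    W H a ≡ true → W H b ≡ true → W H c ≡ true → 2 ≤ edgeCount H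
  triple-two-edges {a} {b} {c} a≢b a≢c b≢c Wa Wb Wc =
    let x , eax           = first-edge (connected a b Wa Wb) a≢b
        z , Wz , z≢a , z≢x = avoiding x
        y , ezy           = first-edge (connected z a Wz Wa) z≢a
    in edgeCount-≥ H ((a , x) ∷ (z , y) ∷ []) (eax ∷ ezy ∷ [])
         (((λ { (inj₁ (z≡a , _)) → z≢a z≡a ; (inj₂ (z≡x , _)) → z≢x z≡x }) ∷ []) ∷ [] ∷ [])
    where
    avoiding : ∀ x → Σ (Fin n) λ z → W H z ≡ true × z ≢ a × z ≢ x
    avoiding x with b ≟ x
    ... | yes refl = c , Wc , a≢c ∘ sym , b≢c ∘ sym
    ... | no b≢x   = b , Wb , a≢b ∘ sym , b≢x

  -- If v is adjacent in G to neither a nor b, a connected subgraph containing v, a, b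
  -- has at least 3 edges: an edge {v, w} at v, an edge {p, q} by which a walk from a to v
  -- leaves P = {a, b}, and an edge {p′, r} at the other vertex p′ of P.  None of them
  -- coincide, because no vertex of P is v or adjacent to v, while q ∉ P.
  nonadjacent-triple-three-edges : {v a b : Fin n} → v ≢ a → v ≢ b → a ≢ b →
    adj G v a ≡ false → adj G v b ≡ false →
    W H v ≡ true → W H a ≡ true → W H b ≡ true → 3 ≤ edgeCount H
  nonadjacent-triple-three-edges {v} {a} {b} v≢a v≢b a≢b va vb Wv Wa Wb =
    let w , evw               = first-edge (connected v a Wv Wa) v≢a
        p , q , Pp , Pq , epq = exit-edge P (connected a v Wa Wv) Pa Pv
        p′ , Pp′ , p′≢p       = other p
        r , ep′r              = first-edge (connected p′ v (W-P Pp′) Wv) (proj₁ (far Pp′))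
        p′-not-q : ¬ SameEdge (p , q) p′ r
        p′-not-q = λ { (inj₁ (p′≡p , _)) → p′≢p p′≡p
                     ; (inj₂ (p′≡q , _)) →
                         false≢true (trans (sym Pq) (subst (λ t → P t ≡ true) p′≡q Pp′)) }
    in edgeCount-≥ H ((v , w) ∷ (p , q) ∷ (p′ , r) ∷ []) (evw ∷ epq ∷ ep′r ∷ [])
         ((avoids w Pp epq ∷ avoids w Pp′ ep′r ∷ []) ∷ (p′-not-q ∷ []) ∷ [] ∷ [])
    where
    P : VSet n
    P = listSet (a ∷ b ∷ [])

    Pa : P a ≡ true
    Pa = listSet-∈ {xs = a ∷ b ∷ []} (here refl)

    Pb : P b ≡ true
    Pb = listSet-∈ {xs = a ∷ b ∷ []} (there (here refl))

    Pv : P v ≡ false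
    Pv = dec-false (any? (v ≟_) (a ∷ b ∷ []))
           λ { (here v≡a) → v≢a v≡a ; (there (here v≡b)) → v≢b v≡b }

    far : ∀ {u} → P u ≡ true → u ≢ v × adj G u v ≡ false
    far {u} Pu with ∈-listSet {xs = a ∷ b ∷ []} {u} Pu
    ... | here refl         = v≢a ∘ sym , trans (adj-sym G a v) va
    ... | there (here refl) = v≢b ∘ sym , trans (adj-sym G b v) vb

    W-P : ∀ {u} → P u ≡ true → W H u ≡ true
    W-P {u} Pu with ∈-listSet {xs = a ∷ b ∷ []} {u} Pu
    ... | here refl         = Wa
    ... | there (here refl) = Wb

    other : ∀ p → Σ (Fin n) λ p′ → P p′ ≡ true × p′ ≢ p
    other p with p ≟ a
    ... | yes refl = b , Pb , a≢b ∘ sym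
    ... | no p≢a   = a , Pa , p≢a ∘ sym

    avoids : ∀ w {u t} → P u ≡ true → E H u t ≡ true → ¬ SameEdge (v , w) u t
    avoids w Pu eut (inj₁ (u≡v , _))  = proj₁ (far Pu) u≡v
    avoids w Pu eut (inj₂ (_ , refl)) = false≢true (trans (sym (proj₂ (far Pu))) (E⊆adj H _ _ eut))

-- Degrees in G and in its complement.

NearlyComplete : Graph n → Set
NearlyComplete G = ∀ v → degree (complement G) v ≤ 1

complement-adj : (G : Graph n) {u v : Fin n} → adj (complement G) u v ≡ true ⇔ (u ≢ v × adj G u v ≡ false)
complement-adj G {u} {v} = mk⇔ to from
  where
  to : not ⌊ u ≟ v ⌋ ∧ not (adj G u v) ≡ true → u ≢ v × adj G u v ≡ false
  to e with u ≟ v | adj G u v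
  ... | no u≢v | false = u≢v , refl
  to () | yes _ | _
  to () | no _  | true
  from : u ≢ v × adj G u v ≡ false → not ⌊ u ≟ v ⌋ ∧ not (adj G u v) ≡ true
  from (u≢v , uv) = cong₂ (λ s t → not s ∧ not t) (trans (isYes≗does (u ≟ v)) (dec-false (u ≟ v) u≢v)) uv

degree-complement : (G : Graph n) (v : Fin n) → suc (degree G v + degree (complement G) v) ≡ n
degree-complement {n} G v = begin
  suc (degree G v + degree Ḡ v)
    ≡⟨ cong₂ (λ d c → suc (d + c)) (countV≡count (adj G v)) (countV≡count (adj Ḡ v)) ⟩
  suc (count (adj G v) + count (adj Ḡ v))
    ≡⟨ sym (+-suc _ _) ⟩
  count (adj G v) + suc (count (adj Ḡ v))
    ≡⟨ cong (count (adj G v) +_) (sym nonNeighbours) ⟩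
  count (adj G v) + count (not ∘ adj G v)
    ≡⟨ count-complement (adj G v) ⟩
  n ∎
  where
  open ≡-Reasoning
  Ḡ : Graph n
  Ḡ = complement G
  -- The non-neighbours of v in G are v itself and its neighbours in Ḡ.
  nonNeighbours : count (not ∘ adj G v) ≡ suc (count (adj Ḡ v))
  nonNeighbours = count-point _ _ v (cong not (adj-irrefl G v)) (adj-irrefl Ḡ v)
    (λ u u≢v → sym (cong (λ s → not s ∧ not (adj G v u))
                         (trans (isYes≗does (v ≟ u)) (dec-false (v ≟ u) (u≢v ∘ sym)))))

≤1⇔n∸2≤ : ∀ {d c n} → suc (d + c) ≡ n → (c ≤ 1 ⇔ n ∸ 2 ≤ d)
≤1⇔n∸2≤ {d} {c} refl = mk⇔ to (from c)
  where
  to : c ≤ 1 → d + c ∸ 1 ≤ d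
  to c≤1 = m≤n+o⇒m∸n≤o (d + c) 1 (≤-trans (+-monoʳ-≤ d c≤1) (≤-reflexive (+-comm d 1)))
  from : ∀ c → d + c ∸ 1 ≤ d → c ≤ 1
  from zero          _  = z≤n
  from (suc zero)    _  = s≤s z≤n
  from (suc (suc c)) le =
    contradiction (subst (_≤ d) (cong (_∸ 1) (+-suc d (suc c))) le) (<⇒≱ (m<m+n d z<s))

≤n∸1 : ∀ {d c n} → suc (d + c) ≡ n → d ≤ n ∸ 1
≤n∸1 {d} {c} refl = m≤m+n d c

maxDeg≤⇔ : (G : Graph n) (k : ℕ) → maxDeg G ≤ k ⇔ (∀ v → degree G v ≤ k)
maxDeg≤⇔ {n} G k = mk⇔ to from
  where
  to : maxDeg G ≤ k → ∀ v → degree G v ≤ k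
  to Δ≤k v = All.lookup (map⁻ (foldr-forcesᵇ {P = _≤ k} split 0 _ Δ≤k)) (∈-allFin v)
    where split = λ x y le → m⊔n≤o⇒m≤o x y le , m⊔n≤o⇒n≤o x y le
  from : (∀ v → degree G v ≤ k) → maxDeg G ≤ k
  from bounded = foldr-preservesᵇ {P = _≤ k} ⊔-lub z≤n (map⁺ (tabulate⁺ bounded))

≤minDeg⇔ : (G : Graph n) (k : ℕ) → k ≤ n → k ≤ minDeg G ⇔ (∀ v → k ≤ degree G v)
≤minDeg⇔ {n} G k k≤n = mk⇔ to from
  where
  to : k ≤ minDeg G → ∀ v → k ≤ degree G v
  to k≤δ v = All.lookup (map⁻ (foldr-forcesᵇ {P = k ≤_} split n _ k≤δ)) (∈-allFin v)
    where split = λ x y le → m≤n⊓o⇒m≤n x y le , m≤n⊓o⇒m≤o x y le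
  from : (∀ v → k ≤ degree G v) → k ≤ minDeg G
  from bounded = foldr-preservesᵇ {P = k ≤_} ⊓-glb k≤n (map⁺ (tabulate⁺ bounded))

minDeg≤degree : (G : Graph n) (v : Fin n) → minDeg G ≤ degree G v
minDeg≤degree {n} G = Equivalence.to (≤minDeg⇔ G (minDeg G) δ≤n) ≤-refl
  where
  δ≤n : minDeg G ≤ n
  δ≤n = foldr-preservesʳ {P = _≤ n} (λ x le → m≤n⇒o⊓m≤n x le) ≤-refl (map (degree G) (allFin n))

nearlyComplete⇔degreeBounds : (G : Graph n) → NearlyComplete G ⇔ (n ∸ 2 ≤ minDeg G × minDeg G ≤ n ∸ 1)
nearlyComplete⇔degreeBounds {n} G = mk⇔ to from
  where
  lowerBound⇔ : n ∸ 2 ≤ minDeg G ⇔ (∀ v → n ∸ 2 ≤ degree G v)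
  lowerBound⇔ = ≤minDeg⇔ G (n ∸ 2) (m∸n≤m n 2)
  δ≤n∸1 : ∀ n (G : Graph n) → minDeg G ≤ n ∸ 1
  δ≤n∸1 zero    G = z≤n
  δ≤n∸1 (suc n) G = ≤-trans (minDeg≤degree G fzero) (≤n∸1 (degree-complement G fzero))
  to : NearlyComplete G → n ∸ 2 ≤ minDeg G × minDeg G ≤ n ∸ 1
  to nc = Equivalence.from lowerBound⇔ (λ v → Equivalence.to (≤1⇔n∸2≤ (degree-complement G v)) (nc v))
        , δ≤n∸1 n G
  from : n ∸ 2 ≤ minDeg G × minDeg G ≤ n ∸ 1 → NearlyComplete G
  from (lower , _) v = Equivalence.from (≤1⇔n∸2≤ (degree-complement G v)) (Equivalence.to lowerBound⇔ lower v)

-- Triples in nearly complete graphs have Steiner distance 2.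

adjacent-to-one-of : {G : Graph n} → NearlyComplete G → {x y z : Fin n} → x ≢ y → x ≢ z → y ≢ z →
  adj G x y ≡ true ⊎ adj G x z ≡ true
adjacent-to-one-of {G = G} nc {x} {y} {z} x≢y x≢z y≢z with adj G x y in xy | adj G x z in xz
... | true  | _    = inj₁ refl
... | false | true = inj₂ refl
... | false | false =
  contradiction (count≤1-unique (adj (complement G) x) (subst (_≤ 1) (countV≡count (adj (complement G) x)) (nc x))
                  (Equivalence.from (complement-adj G) (x≢y , xy))
                  (Equivalence.from (complement-adj G) (x≢z , xz)))
                y≢z

Centre : Graph n → Fin n → Fin n → Fin n → Set
Centre {n} G a b c = Σ (Fin n) λ m → Σ (Fin n) λ u → Σ (Fin n) λ w →
  adj G m u ≡ true × adj G m w ≡ true × (a ∷ b ∷ c ∷ []) ↭ (m ∷ u ∷ w ∷ [])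

centre : {G : Graph n} → NearlyComplete G → {a b c : Fin n} → a ≢ b → a ≢ c → b ≢ c → Centre G a b c
centre {G = G} nc {a} {b} {c} a≢b a≢c b≢c with adj G a b in ab | adj G a c in ac
... | true  | true  = a , b , c , ab , ac , ↭-refl
... | false | _     = c , a , b , trans (adj-sym G c a) a~c , trans (adj-sym G c b) b~c , shift c (a ∷ b ∷ []) []
  where
  a~c : adj G a c ≡ true
  a~c with adjacent-to-one-of {G = G} nc a≢b a≢c b≢c
  ... | inj₁ a~b = contradiction (trans (sym ab) a~b) (λ ())
  ... | inj₂ a~c = a~c
  b~c : adj G b c ≡ true
  b~c with adjacent-to-one-of {G = G} nc (a≢b ∘ sym) b≢c a≢c
  ... | inj₁ b~a = contradiction (trans (sym ab) (trans (adj-sym G a b) b~a)) (λ ())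
  ... | inj₂ b~c = b~c
... | true  | false = b , a , c , trans (adj-sym G b a) ab , trans (adj-sym G b c) c~b , swap a b ↭-refl
  where
  c~b : adj G c b ≡ true
  c~b with adjacent-to-one-of {G = G} nc (a≢c ∘ sym) (b≢c ∘ sym) a≢b
  ... | inj₁ c~a = contradiction (trans (sym ac) (trans (adj-sym G a c) c~a)) (λ ())
  ... | inj₂ c~b = c~b

module Cherry (G : Graph n) {m u w : Fin n} (mu : adj G m u ≡ true) (mw : adj G m w ≡ true) where

  vertices : List (Fin n)
  vertices = m ∷ u ∷ w ∷ []

  edges : List (Edge n)
  edges = (m , u) ∷ (m , w) ∷ []

  private
    in-G : ∀ i j → edgesOf edges i j ≡ true → adj G i j ≡ true
    in-G i j e with edgesOf-covers edges i j e
    ... | here (inj₁ (refl , refl))         = mu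
    ... | here (inj₂ (refl , refl))         = trans (adj-sym G u m) mu
    ... | there (here (inj₁ (refl , refl))) = mw
    ... | there (here (inj₂ (refl , refl))) = trans (adj-sym G w m) mw

    ends : ∀ i j → edgesOf edges i j ≡ true → listSet vertices i ≡ true
    ends i j e with edgesOf-covers edges i j e
    ... | here (inj₁ (refl , _))         = listSet-∈ {xs = vertices} (here refl)
    ... | here (inj₂ (refl , _))         = listSet-∈ {xs = vertices} (there (here refl))
    ... | there (here (inj₁ (refl , _))) = listSet-∈ {xs = vertices} (here refl)
    ... | there (here (inj₂ (refl , _))) = listSet-∈ {xs = vertices} (there (there (here refl)))

  H : Subgraph G
  H = record { W = listSet vertices ; E = edgesOf edges ; E⊆adj = in-G
             ; E-sym = edgesOf-symmetric edges ; E-ends = ends }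

  private
    to-centre : ∀ x → listSet vertices x ≡ true → Reach (edgesOf edges) x m
    to-centre x Wx with ∈-listSet {xs = vertices} {x} Wx
    ... | here refl                 = here
    ... | there (here refl)         = step (edgesOf-∋ edges (here (inj₂ (refl , refl)))) here
    ... | there (there (here refl)) = step (edgesOf-∋ edges (there (here (inj₂ (refl , refl))))) here

  connected : SubConnected H
  connected x y Wx Wy = reach-trans (to-centre x Wx) (reach-sym (edgesOf-symmetric edges) (to-centre y Wy))

  at-most-two-edges : edgeCount H ≤ 2
  at-most-two-edges = edgeCount-≤ H edges (edgesOf-covers edges)

triple-distance : (G : Graph n) → NearlyComplete G → (S : VSet n) {a b c : Fin n} →
  a ≢ b → a ≢ c → b ≢ c → (∀ y → S y ≡ listSet (a ∷ b ∷ c ∷ []) y) → SteinerDist G S 2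
triple-distance G nc S {a} {b} {c} a≢b a≢c b≢c S≡abc with centre {G = G} nc a≢b a≢c b≢c
... | m , u , w , mu , mw , abc↭muw =
  (C.H , C.connected , contains , ≤-antisym C.at-most-two-edges (at-least-two C.H C.connected contains))
  , at-least-two
  where
  module C = Cherry G mu mw
  contains : Contains C.H S
  contains y Sy = listSet-∈ {xs = C.vertices} {y}
                    (∈-resp-↭ abc↭muw (∈-listSet {xs = a ∷ b ∷ c ∷ []} {y} (trans (sym (S≡abc y)) Sy)))
  at-least-two : ∀ H → SubConnected H → Contains H S → 2 ≤ edgeCount H
  at-least-two H conn cont =
    triple-two-edges H conn a≢b a≢c b≢c
      (W∋ (here refl)) (W∋ (there (here refl))) (W∋ (there (there (here refl))))
    where
    W∋ : ∀ {y} → y ∈ (a ∷ b ∷ c ∷ []) → W H y ≡ true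
    W∋ {y} y∈ = cont y (trans (S≡abc y) (listSet-∈ y∈))

card-listSet : (xs : List (Fin n)) → Unique xs → card (listSet xs) ≡ length xs
card-listSet xs unique = trans (countV≡count (listSet xs)) (count-listSet xs unique)

three-vertices : (S : VSet n) → card S ≡ 3 → Σ (Fin n) λ a → Σ (Fin n) λ b → Σ (Fin n) λ c →
  a ≢ b × a ≢ c × b ≢ c × (∀ y → S y ≡ listSet (a ∷ b ∷ c ∷ []) y)
three-vertices {n} S size =
  let xs , unique , len , S≡xs = enumerate 3 S (trans (sym (countV≡count S)) size)
  in fromList xs unique len S≡xs
  where
  fromList : (xs : List (Fin n)) → Unique xs → length xs ≡ 3 → (∀ y → S y ≡ listSet xs y) →
    Σ (Fin n) λ a → Σ (Fin n) λ b → Σ (Fin n) λ c →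
    a ≢ b × a ≢ c × b ≢ c × (∀ y → S y ≡ listSet (a ∷ b ∷ c ∷ []) y)
  fromList (a ∷ b ∷ c ∷ []) ((a≢b ∷ a≢c ∷ []) ∷ (b≢c ∷ []) ∷ [] ∷ []) _ S≡abc =
    a , b , c , a≢b , a≢c , b≢c , S≡abc
  fromList []                    _ () _
  fromList (_ ∷ [])              _ () _
  fromList (_ ∷ _ ∷ [])          _ () _
  fromList (_ ∷ _ ∷ _ ∷ _ ∷ _)   _ () _

-- sdiam₃(G) = 2 exactly for nearly complete G.

nearlyComplete⇒sdiam₃≡2 : (G : Graph n) → 3 ≤ n → NearlyComplete G → SteinerDiam G 3 2
nearlyComplete⇒sdiam₃≡2 {suc (suc (suc k))} G _ nc =
  (listSet xs , card-listSet xs distinct , triple-distance G nc (listSet xs) (λ ()) (λ ()) (λ ()) (λ _ → refl))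
  , λ S size → let a , b , c , a≢b , a≢c , b≢c , S≡abc = three-vertices S size
               in 2 , triple-distance G nc S a≢b a≢c b≢c S≡abc , ≤-refl
  where
  xs : List (Fin (3 + k))
  xs = fzero ∷ fsuc fzero ∷ fsuc (fsuc fzero) ∷ []
  distinct : Unique xs
  distinct = ((λ ()) ∷ (λ ()) ∷ []) ∷ ((λ ()) ∷ []) ∷ [] ∷ []
nearlyComplete⇒sdiam₃≡2 {suc (suc zero)} G (s≤s (s≤s ())) _
nearlyComplete⇒sdiam₃≡2 {suc zero}       G (s≤s ())       _

-- A vertex v with two non-neighbours a, b makes {v, a, b} need three edges.
sdiam₃≡2⇒nearlyComplete : (G : Graph n) → SteinerDiam G 3 2 → NearlyComplete G
sdiam₃≡2⇒nearlyComplete G (_ , bounded) v with degree (complement G) v ≤? 1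
... | yes deg≤1 = deg≤1
... | no  deg≰1 =
  let a , b , a≢b , v̄a , v̄b = 2≤count-two (adj (complement G) v)
                                 (subst (2 ≤_) (countV≡count (adj (complement G) v)) (≰⇒> deg≰1))
      v≢a , va = Equivalence.to (complement-adj G) v̄a
      v≢b , vb = Equivalence.to (complement-adj G) v̄b
      xs = v ∷ a ∷ b ∷ []
      d , ((H , conn , cont , size) , _) , d≤2 =
        bounded (listSet xs) (card-listSet xs ((v≢a ∷ v≢b ∷ []) ∷ (a≢b ∷ []) ∷ [] ∷ []))
      W∋ : ∀ {y} → y ∈ xs → W H y ≡ true
      W∋ {y} y∈ = cont y (listSet-∈ y∈)
  in contradiction
       (≤-trans (nonadjacent-triple-three-edges H conn v≢a v≢b a≢b va vb
                   (W∋ (here refl)) (W∋ (there (here refl))) (W∋ (there (there (here refl)))))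
                (≤-trans (≤-reflexive size) d≤2))
       λ { (s≤s (s≤s ())) }

theorem2 : ∀ (n : ℕ) (G : Graph n) → 3 ≤ n → Connected G →
    (SteinerDiam G 3 2 ⇔ (0 ≤ maxDeg (complement G) × maxDeg (complement G) ≤ 1))
    × ((0 ≤ maxDeg (complement G) × maxDeg (complement G) ≤ 1) ⇔ (n ∸ 2 ≤ minDeg G × minDeg G ≤ n ∸ 1))
theorem2 n G n≥3 _ =
  mk⇔ (λ sdiam → z≤n , Equivalence.from Δ̄≤1⇔ (sdiam₃≡2⇒nearlyComplete G sdiam))
      (λ (_ , Δ̄≤1) → nearlyComplete⇒sdiam₃≡2 G n≥3 (Equivalence.to Δ̄≤1⇔ Δ̄≤1))
  , mk⇔ (λ (_ , Δ̄≤1) → Equivalence.to (nearlyComplete⇔degreeBounds G) (Equivalence.to Δ̄≤1⇔ Δ̄≤1))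
        (λ bounds → z≤n , Equivalence.from Δ̄≤1⇔ (Equivalence.from (nearlyComplete⇔degreeBounds G) bounds))
  where
  Δ̄≤1⇔ : maxDeg (complement G) ≤ 1 ⇔ NearlyComplete G
  Δ̄≤1⇔ = maxDeg≤⇔ (complement G) 1
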